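{- Let $(\mathcal{L},\models,\mathfrak{M})$ be a satisfaction system with finite $\mathcal{L}$ and let $\Phi_1,\ldots,\Phi_n\subseteq\mathcal{L}$ be non-trivial sets of statements. If $\bigcup_{i=1}^n\Phi_i$ is consistent, then $\bigcup_{i=1}^n\Phi_i$ is a middle ground for $\Phi_1,\ldots,\Phi_n$, i.e., it satisfies (P1)–(P5).
   Context: A satisfaction system is a triple $(\mathcal{L},\models,\mathfrak{M})$ where $\mathcal{L}$ is a language (a set of statements), $\mathfrak{M}$ a set of models and $\models\subseteq\mathfrak{M}\times\mathcal{L}$ a satisfaction relation. For $\Phi\subseteq\mathcal{L}$, $\pi\models\Phi$ iff $\pi\models\phi$ for all $\phi\in\Phi$; $\mathsf{mod}(\Phi)$ is the set of models $\pi\in\mathfrak{M}$ with $\pi\models\Phi$; $\Phi\models\Phi'$ iff every $\pi\in\mathfrak{M}$ with $\pi\models\Phi$ satisfies $\pi\models\Phi'$; $\Phi\equiv\Phi'$ iff $\Phi\models\Phi'$ and $\Phi'\models\Phi$. A statement $\phi$ is identified with $\{\phi\}$. $\Phi$ is consistent if $\mathsf{mod}(\Phi)\neq\emptyset$, falsifiable if $\mathsf{mod}(\Phi)\neq\mathfrak{M}$, and non-trivial if it is consistent and falsifiable. Given non-trivial sets $\Phi_1,\ldots,\Phi_n\subseteq\mathcal{L}$, a set $\Phi\subseteq\mathcal{L}$ is a middle ground for $\Phi_1,\ldots,\Phi_n$ if: (P1) $\Phi$ is non-trivial; (P2) if $\bigcup_{i=1}^n\Phi_i$ is consistent then $\Phi\equiv\bigcup_{i=1}^n\Phi_i$;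 (P3) for each $\phi\in\Phi$, all $i\in\{1,\ldots,n\}$ and all $\phi_i\in\Phi_i$ there is $\pi\in\mathfrak{M}$ with $\pi\models\phi$ and $\pi\models\phi_i$; (P4) for each $\phi\in\Phi$ there is $i$ with $\Phi_i\models\phi$; (P5) there is no $\Phi'\subseteq\mathcal{L}$ with $\Phi'\models\Phi$, $\Phi\not\models\Phi'$ and $\Phi'$ satisfying (P1)–(P4). -}

module Defs where

open import Level using (0ℓ)
open import Data.Nat using (ℕ)
open import Data.Fin using (Fin)
open import Data.Product using (Σ; ∃; _×_)
open import Function.Bundles using (_↔_)
open import Relation.Nullary using (¬_)
open import Relation.Unary using (Pred; _∈_)

record SatisfactionSystem : Set₁ where
  field
    L   : Set
    M   : Set
    _⊨_ : M → L → Set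

module _ (S : SatisfactionSystem) where
  open SatisfactionSystem S

  Stmts : Set₁
  Stmts = Pred L 0ℓ

  FiniteLanguage : Set
  FiniteLanguage = Σ ℕ λ k → L ↔ Fin k

  _⊨ˢ_ : M → Stmts → Set
  π ⊨ˢ Φ = ∀ φ → φ ∈ Φ → π ⊨ φ

  _⊫_ : Stmts → Stmts → Set
  Φ ⊫ Φ' = ∀ π → π ⊨ˢ Φ → π ⊨ˢ Φ'

  _≋_ : Stmts → Stmts → Set
  Φ ≋ Φ' = (Φ ⊫ Φ') × (Φ' ⊫ Φ)

  -- mod(Φ) ≠ ∅  (read as: mod(Φ) is inhabited)
  Consistent : Stmts → Set
  Consistent Φ = ∃ λ π → π ⊨ˢ Φ

  Falsifiable : Stmts → Set
  Falsifiable Φ = ¬ (∀ π → π ⊨ˢ Φ)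

  NonTrivial : Stmts → Set
  NonTrivial Φ = Consistent Φ × Falsifiable Φ

  ⋃ : {n : ℕ} → (Fin n → Stmts) → Stmts
  ⋃ {n} Φs φ = ∃ λ (i : Fin n) → φ ∈ Φs i

  module _ {n : ℕ} (Φs : Fin n → Stmts) where

    P1 : Stmts → Set
    P1 Φ = NonTrivial Φ

    P2 : Stmts → Set
    P2 Φ = Consistent (⋃ Φs) → Φ ≋ ⋃ Φs

    P3 : Stmts → Set
    P3 Φ = ∀ φ → φ ∈ Φ → ∀ (i : Fin n) → ∀ φᵢ → φᵢ ∈ Φs i →
           ∃ λ π → (π ⊨ φ) × (π ⊨ φᵢ)

    -- Φ_i ⊨ φ, with φ identified with {φ}
    P4 : Stmts → Set
    P4 Φ = ∀ φ → φ ∈ Φ → ∃ λ (i : Fin n) → ∀ π → π ⊨ˢ Φs i → π ⊨ φ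

    P5 : Stmts → Set₁
    P5 Φ = ¬ (Σ Stmts λ Φ' → (Φ' ⊫ Φ) × ¬ (Φ ⊫ Φ') ×
                              P1 Φ' × P2 Φ' × P3 Φ' × P4 Φ')

    record MiddleGround (Φ : Stmts) : Set₁ where
      field
        p1 : P1 Φ
        p2 : P2 Φ
        p3 : P3 Φ
        p4 : P4 Φ
        p5 : P5 Φ

{-# OPTIONS --safe #-}
module Submission where

-- When ⋃ Φs is consistent, (P2) makes every candidate middle ground
-- equivalent to ⋃ Φs, so no candidate is strictly stronger than ⋃ Φs and
-- (P5) holds. A single model of ⋃ Φs witnesses its consistency and every
-- pair needed in (P3); falsifiability is inherited from any one Φᵢ, which
-- is where n ≥ 1 is needed.

open import Defs
open import Data.Nat using (ℕ; suc; _≤_; s≤s)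
open import Data.Fin using (Fin; zero)
open import Data.Product using (_,_; proj₂)
open import Function using (_∘′_)
open import Relation.Unary using (_⊆_)

module _ (S : SatisfactionSystem) where

  ⊫-refl : ∀ {Φ} → _⊫_ S Φ Φ
  ⊫-refl π π⊨Φ = π⊨Φ

  ⊫-trans : ∀ {Φ Ψ Χ} → _⊫_ S Φ Ψ → _⊫_ S Ψ Χ → _⊫_ S Φ Χ
  ⊫-trans Φ⊫Ψ Ψ⊫Χ π = Ψ⊫Χ π ∘′ Φ⊫Ψ π

  ≋-refl : ∀ {Φ} → _≋_ S Φ Φ
  ≋-refl = ⊫-refl , ⊫-refl

  ⊆⇒⊫ : ∀ {Φ Ψ} → Φ ⊆ Ψ → _⊫_ S Ψ Φ
  ⊆⇒⊫ Φ⊆Ψ π π⊨Ψ φ φ∈Φ = π⊨Ψ φ (Φ⊆Ψ φ∈Φ)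

  ⊫-falsifiable : ∀ {Φ Ψ} → _⊫_ S Ψ Φ → Falsifiable S Φ → Falsifiable S Ψ
  ⊫-falsifiable Ψ⊫Φ Φ-falsifiable ⊨Ψ = Φ-falsifiable (λ π → Ψ⊫Φ π (⊨Ψ π))

  module _ {n : ℕ} (Φs : Fin n → Stmts S) where

    Φᵢ⊆⋃ : ∀ i → Φs i ⊆ ⋃ S Φs
    Φᵢ⊆⋃ i φ∈Φᵢ = i , φ∈Φᵢ

    ⋃-falsifiable : ∀ i → Falsifiable S (Φs i) → Falsifiable S (⋃ S Φs)
    ⋃-falsifiable i = ⊫-falsifiable (⊆⇒⊫ (Φᵢ⊆⋃ i))

    ⋃-P2 : P2 S Φs (⋃ S Φs)
    ⋃-P2 _ = ≋-refl

    consistent⇒⋃-P3 : Consistent S (⋃ S Φs) → P3 S Φs (⋃ S Φs)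
    consistent⇒⋃-P3 (π , π⊨⋃) φ φ∈⋃ i φᵢ φᵢ∈Φᵢ =
      π , π⊨⋃ φ φ∈⋃ , π⊨⋃ φᵢ (Φᵢ⊆⋃ i φᵢ∈Φᵢ)

    ⋃-P4 : P4 S Φs (⋃ S Φs)
    ⋃-P4 φ (i , φ∈Φᵢ) = i , λ π π⊨Φᵢ → π⊨Φᵢ φ φ∈Φᵢ

    consistent⇒P5 : ∀ {Φ} → Consistent S (⋃ S Φs) → _⊫_ S Φ (⋃ S Φs) →
                    P5 S Φs Φ
    consistent⇒P5 consistent Φ⊫⋃ (Φ' , _ , Φ⊭Φ' , _ , Φ'-P2 , _) =
      Φ⊭Φ' (⊫-trans Φ⊫⋃ (proj₂ (Φ'-P2 consistent)))

proposition1 : (S : SatisfactionSystem) → FiniteLanguage S →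
    (n : ℕ) → 1 ≤ n → (Φs : Fin n → Stmts S) →
    (∀ i → NonTrivial S (Φs i)) →
    Consistent S (⋃ S Φs) →
    MiddleGround S Φs (⋃ S Φs)
proposition1 S _ (suc n) (s≤s _) Φs nontrivial consistent = record
  { p1 = consistent , ⋃-falsifiable S Φs zero (proj₂ (nontrivial zero))
  ; p2 = ⋃-P2 S Φs
  ; p3 = consistent⇒⋃-P3 S Φs consistent
  ; p4 = ⋃-P4 S Φs
  ; p5 = consistent⇒P5 S Φs consistent (⊫-refl S)
  }
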